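{- Let $m$ be an even positive integer. For every $f:\{ -1,1\}^n\to\{ -1,1\}$ define $\Phi[f]:[m]^n\to\{ -1,1\}$ by \[\Phi[f](x_1,\ldots,x_n)=f\big(\mathbb{1}[x_1>m/2],\ldots,\mathbb{1}[x_n>m/2]\big),\] where $\mathbb{1}[P]=1$ if $P$ is true and $-1$ otherwise. Then: (1) if $f$ is monotone then $\Phi[f]$ is monotone; (2) if $f$ is $\epsilon$-far from monotone then $\Phi[f]$ is $\epsilon$-far from monotone.
   Context: $[m]=\{1,\dots,m\}$. On $\{ -1,1\}^n$ (with $-1<1$) and on $[m]^n$, $x\prec y$ means $x_i\le y_i$ for all $i$ and $x\ne y$; a $\{ -1,1\}$-valued function $g$ is monotone if $g(x)\le g(y)$ whenever $x\prec y$. A function $g$ on a domain $D\in\{\{ -1,1\}^n,[m]^n\}$ is $\epsilon$-far from monotone if for every monotone $h$ on $D$, $\Pr_{\mathbf{x}}[g(\mathbf{x})\ne h(\mathbf{x})]>\epsilon$ with $\mathbf{x}$ uniform on $D$.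
   Formalization: The parameter ε in ε-far from monotone ranges over the rationals. -}

module Defs where

open import Data.Nat as ℕ using (ℕ; zero; suc; _/_; _<_)
open import Data.Nat.Properties using (_<?_)
open import Data.Fin using (Fin; toℕ)
open import Data.Vec using (Vec; []; _∷_; lookup; map)
open import Data.List as List using (List; []; _∷_; length; filter; allFin; cartesianProductWith; concatMap)
open import Data.Integer using (+_)
open import Data.Rational as ℚ using (ℚ)
open import Data.Product using (_×_; ∃)
open import Relation.Nullary using (¬_; Dec; yes; no)
open import Relation.Nullary.Decidable using (¬?)
open import Relation.Binary.PropositionalEquality using (_≡_; _≢_; refl)

data PM : Set where
  neg pos : PM

data _≤±_ : PM → PM → Set where
  neg≤ : ∀ {b} → neg ≤± b
  pos≤pos : pos ≤± pos

_≟±_ : (a b : PM) → Dec (a ≡ b)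
neg ≟± neg = yes refl
neg ≟± pos = no (λ ())
pos ≟± neg = no (λ ())
pos ≟± pos = yes refl

_≺_ : ∀ {A : Set} {n} → {_≤A_ : A → A → Set} → Vec A n → Vec A n → Set
_≺_ {n = n} {_≤A_} x y = (∀ (i : Fin n) → lookup x i ≤A lookup y i) × (x ≢ y)

Monotone : ∀ {A : Set} {n} (_≤A_ : A → A → Set) → (Vec A n → PM) → Set
Monotone {n = n} _≤A_ g = ∀ (x y : Vec _ n) → _≺_ {_≤A_ = _≤A_} x y → g x ≤± g y

-- coordinate order on [m] = {1..m}, represented by Fin m (i stands for toℕ i + 1)
_≤Fin_ : ∀ {m} → Fin m → Fin m → Set
i ≤Fin j = toℕ i ℕ.≤ toℕ j

allVecs : ∀ {A : Set} → List A → (n : ℕ) → List (Vec A n)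
allVecs xs zero = [] ∷ []
allVecs xs (suc n) = cartesianProductWith _∷_ xs (allVecs xs n)

cube : (n : ℕ) → List (Vec PM n)
cube n = allVecs (neg ∷ pos ∷ []) n

grid : (m n : ℕ) → List (Vec (Fin m) n)
grid m n = allVecs (allFin m) n

disagree : ∀ {D : Set} → List D → (D → PM) → (D → PM) → ℕ
disagree dom g h = length (filter (λ x → ¬? (g x ≟± h x)) dom)

ℕtoℚ : ℕ → ℚ
ℕtoℚ k = (+ k) ℚ./ 1

-- g is ε-far from monotone: for every monotone h,
-- Pr_x[g x ≠ h x] = disagree/|D| > ε, written as ε·|D| < disagree (|D| > 0)
FarFromMonotone : ∀ {A : Set} {n} (_≤A_ : A → A → Set) → List (Vec A n) → ℚ → (Vec A n → PM) → Set
FarFromMonotone {n = n} _≤A_ dom ε g =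
  ∀ (h : Vec _ n → PM) → Monotone _≤A_ h →
    ε ℚ.* ℕtoℚ (length dom) ℚ.< ℕtoℚ (disagree dom g h)

-- 𝟙[x > m/2] for x ∈ [m] represented by i : Fin m (x = toℕ i + 1)
ind : ∀ {m} → Fin m → PM
ind {m} i with (m / 2) <? suc (toℕ i)
... | yes _ = pos
... | no _ = neg

Φ : ∀ {m n} → (Vec PM n → PM) → Vec (Fin m) n → PM
Φ f x = f (map ind x)

Even : ℕ → Set
Even m = ∃ λ k → m ≡ k ℕ.+ k

module Submission where

open import Defs
open import Data.Nat using (ℕ; _<_)
open import Data.Product using (_×_)
open import Data.Rational using (ℚ)
open import Data.Vec using (Vec)

open import Data.Fin as Fin using (Fin; toℕ; _↑ˡ_; _↑ʳ_)
import Data.Fin.Properties as Fin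
import Data.Integer as ℤ
import Data.Integer.Properties as ℤ
open import Data.List using (List; []; _∷_; _++_; map; length; tabulate; allFin; cartesianProductWith)
open import Data.List.Properties using (map-cong; map-++; map-∘; map-tabulate; length-map; length-++-≤ˡ)
open import Data.Nat as ℕ using (zero; suc; _+_; _≤_; z<s; s≤s)
open import Data.Nat.DivMod using (m*n/n≡m)
open import Data.Nat.ListAction using (sum)
open import Data.Nat.ListAction.Properties using (sum-++)
import Data.Nat.Properties as ℕ
open import Algebra.Properties.CommutativeSemigroup ℕ.+-commutativeSemigroup using (interchange)
open import Data.Product using (_,_)
open import Data.Rational as ℚ using (toℚᵘ)
import Data.Rational.Properties as ℚ
open import Data.Rational.Unnormalised as ℚᵘ using (ℚᵘ; mkℚᵘ; *≡*)
import Data.Rational.Unnormalised.Properties as ℚᵘ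
open import Data.Vec as Vec using ([]; _∷_; lookup; zipWith)
import Data.Vec.Properties as Vec
open import Function using (_∘_; id)
open import Relation.Binary.Definitions using (DecidableEquality)
open import Relation.Binary.PropositionalEquality
open import Relation.Nullary using (yes; no; contradiction)

-- For m = 2k, every x ∈ [2k] is uniquely j or k + j with j ∈ [k], and x > k exactly in the
-- second case. So [2k]^n is the disjoint union, over z ∈ [k]^n, of the copies
-- {z + k·𝟙[b = 1] : b ∈ {-1,1}^n} of the cube, on each of which Φ[f] is f. A monotone h on the
-- grid restricts to a monotone function on each copy, which disagrees with f on more than ε·2^n
-- points; summing over the k^n copies, h disagrees with Φ[f] on more than ε·(2k)^n points.
-- Monotonicity is preserved because 𝟙[x > m/2] is monotone in x.

private
  variable
    A B C : Set

∑ : List A → (A → ℕ) → ℕ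
∑ xs g = sum (map g xs)

∑-cong : (xs : List A) {g g′ : A → ℕ} → (∀ x → g x ≡ g′ x) → ∑ xs g ≡ ∑ xs g′
∑-cong xs g≗g′ = cong sum (map-cong g≗g′ xs)

∑-++ : (xs ys : List A) (g : A → ℕ) → ∑ (xs ++ ys) g ≡ ∑ xs g + ∑ ys g
∑-++ xs ys g = trans (cong sum (map-++ g xs ys)) (sum-++ (map g xs) (map g ys))

∑-map : (h : A → B) (xs : List A) (g : B → ℕ) → ∑ (map h xs) g ≡ ∑ xs (g ∘ h)
∑-map h xs g = cong sum (sym (map-∘ xs))

∑-tabulate : ∀ {n} (h : Fin n → A) (g : A → ℕ) → ∑ (tabulate h) g ≡ ∑ (allFin n) (g ∘ h)
∑-tabulate h g = cong sum (trans (map-tabulate h g) (sym (map-tabulate id (g ∘ h))))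

∑-zero : (xs : List A) → ∑ xs (λ _ → 0) ≡ 0
∑-zero []       = refl
∑-zero (x ∷ xs) = ∑-zero xs

∑-+ : (xs : List A) (g g′ : A → ℕ) → ∑ xs (λ x → g x + g′ x) ≡ ∑ xs g + ∑ xs g′
∑-+ []       g g′ = refl
∑-+ (x ∷ xs) g g′ = trans (cong (g x + g′ x +_) (∑-+ xs g g′)) (interchange (g x) (g′ x) _ _)

∑-comm : (xs : List A) (ys : List B) (G : A → B → ℕ) →
  ∑ xs (λ x → ∑ ys (G x)) ≡ ∑ ys (λ y → ∑ xs (λ x → G x y))
∑-comm []       ys G = sym (∑-zero ys)
∑-comm (x ∷ xs) ys G =
  trans (cong (∑ ys (G x) +_) (∑-comm xs ys G)) (sym (∑-+ ys (G x) _))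

∑-cartesianProductWith : (f : A → B → C) (xs : List A) (ys : List B) (F : C → ℕ) →
  ∑ (cartesianProductWith f xs ys) F ≡ ∑ xs (λ x → ∑ ys (F ∘ f x))
∑-cartesianProductWith f []       ys F = refl
∑-cartesianProductWith f (x ∷ xs) ys F = begin
  ∑ (map (f x) ys ++ cartesianProductWith f xs ys) F          ≡⟨ ∑-++ (map (f x) ys) _ F ⟩
  ∑ (map (f x) ys) F + ∑ (cartesianProductWith f xs ys) F     ≡⟨ cong₂ _+_ (∑-map (f x) ys F) (∑-cartesianProductWith f xs ys F) ⟩
  ∑ ys (F ∘ f x) + ∑ xs (λ x′ → ∑ ys (F ∘ f x′))              ∎
  where open ≡-Reasoning

∑-allVecs-zipWith : (f : A → B → C) (xs : List A) (ys : List B) (zs : List C) →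
  (∀ G → ∑ zs G ≡ ∑ xs (λ x → ∑ ys (G ∘ f x))) →
  ∀ n (F : Vec C n → ℕ) → ∑ (allVecs zs n) F ≡ ∑ (allVecs xs n) (λ u → ∑ (allVecs ys n) (F ∘ zipWith f u))
∑-allVecs-zipWith f xs ys zs split zero    F = sym (ℕ.+-identityʳ _)
∑-allVecs-zipWith f xs ys zs split (suc n) F = begin
  ∑ (allVecs zs (suc n)) F
    ≡⟨ ∑-cartesianProductWith _∷_ zs (allVecs zs n) F ⟩
  ∑ zs (λ c → ∑ (allVecs zs n) (F ∘ (c ∷_)))
    ≡⟨ split _ ⟩
  ∑ xs (λ x → ∑ ys (λ y → ∑ (allVecs zs n) (F ∘ (f x y ∷_))))
    ≡⟨ ∑-cong xs (λ x → ∑-cong ys (λ y → ∑-allVecs-zipWith f xs ys zs split n (F ∘ (f x y ∷_)))) ⟩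
  ∑ xs (λ x → ∑ ys (λ y → ∑ (allVecs xs n) (λ u → ∑ (allVecs ys n) (F ∘ zipWith f (x ∷ u) ∘ (y ∷_)))))
    ≡⟨ ∑-cong xs (λ x → ∑-comm ys (allVecs xs n) _) ⟩
  ∑ xs (λ x → ∑ (allVecs xs n) (λ u → ∑ ys (λ y → ∑ (allVecs ys n) (F ∘ zipWith f (x ∷ u) ∘ (y ∷_)))))
    ≡⟨ ∑-cong xs (λ x → ∑-cong (allVecs xs n) (λ u → ∑-cartesianProductWith _∷_ ys (allVecs ys n) _)) ⟨
  ∑ xs (λ x → ∑ (allVecs xs n) (λ u → ∑ (allVecs ys (suc n)) (F ∘ zipWith f (x ∷ u))))
    ≡⟨ ∑-cartesianProductWith _∷_ xs (allVecs xs n) _ ⟨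
  ∑ (allVecs xs (suc n)) (λ u → ∑ (allVecs ys (suc n)) (F ∘ zipWith f u))
    ∎
  where open ≡-Reasoning

length≡∑1 : (xs : List A) → length xs ≡ ∑ xs (λ _ → 1)
length≡∑1 []       = refl
length≡∑1 (x ∷ xs) = cong suc (length≡∑1 xs)

allVecs-nonempty : ∀ {x : A} {xs} n → 0 < length (allVecs (x ∷ xs) n)
allVecs-nonempty zero = z<s
allVecs-nonempty {x = x} {xs} (suc n) =
  ℕ.<-≤-trans (allVecs-nonempty n) (ℕ.≤-trans (ℕ.≤-reflexive (sym (length-map (x ∷_) tails))) (length-++-≤ˡ (map (x ∷_) tails)))
  where tails = allVecs (x ∷ xs) n

mismatch : PM → PM → ℕ
mismatch neg neg = 0
mismatch neg pos = 1
mismatch pos neg = 1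
mismatch pos pos = 0

disagree≡∑mismatch : (dom : List A) (g h : A → PM) → disagree dom g h ≡ ∑ dom (λ x → mismatch (g x) (h x))
disagree≡∑mismatch []       g h = refl
disagree≡∑mismatch (x ∷ dom) g h with g x | h x
... | neg | neg = disagree≡∑mismatch dom g h
... | neg | pos = cong suc (disagree≡∑mismatch dom g h)
... | pos | neg = cong suc (disagree≡∑mismatch dom g h)
... | pos | pos = disagree≡∑mismatch dom g h

tabulate-+ : ∀ a {b} (h : Fin (a + b) → A) → tabulate h ≡ tabulate (h ∘ (_↑ˡ b)) ++ tabulate (h ∘ (a ↑ʳ_))
tabulate-+ zero    h = refl
tabulate-+ (suc a) h = cong (h Fin.zero ∷_) (tabulate-+ a (h ∘ Fin.suc))

place : ∀ {k} → Fin k → PM → Fin (k + k)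
place {k} j neg = j ↑ˡ k
place {k} j pos = k ↑ʳ j

toℕ-place-neg<k : ∀ {k} (j : Fin k) → toℕ (place j neg) < k
toℕ-place-neg<k {k} j = subst (_< k) (sym (Fin.toℕ-↑ˡ j k)) (Fin.toℕ<n j)

k≤toℕ-place-pos : ∀ {k} (j : Fin k) → k ≤ toℕ (place j pos)
k≤toℕ-place-pos {k} j = subst (k ≤_) (sym (Fin.toℕ-↑ʳ k j)) (ℕ.m≤m+n k (toℕ j))

∑-allFin-double : ∀ k (G : Fin (k + k) → ℕ) →
  ∑ (allFin (k + k)) G ≡ ∑ (allFin k) (λ j → ∑ (neg ∷ pos ∷ []) (G ∘ place j))
∑-allFin-double k G = begin
  ∑ (allFin (k + k)) G
    ≡⟨ cong (λ l → ∑ l G) (tabulate-+ k id) ⟩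
  ∑ (tabulate (_↑ˡ k) ++ tabulate (k ↑ʳ_)) G
    ≡⟨ ∑-++ (tabulate (_↑ˡ k)) _ G ⟩
  ∑ (tabulate (_↑ˡ k)) G + ∑ (tabulate (k ↑ʳ_)) G
    ≡⟨ cong₂ _+_ (∑-tabulate (_↑ˡ k) G) (∑-tabulate (k ↑ʳ_) G) ⟩
  ∑ (allFin k) (λ j → G (j ↑ˡ k)) + ∑ (allFin k) (λ j → G (k ↑ʳ j))
    ≡⟨ ∑-+ (allFin k) _ _ ⟨
  ∑ (allFin k) (λ j → G (j ↑ˡ k) + G (k ↑ʳ j))
    ≡⟨ ∑-cong (allFin k) (λ j → cong (G (j ↑ˡ k) +_) (ℕ.+-identityʳ _)) ⟨
  ∑ (allFin k) (λ j → ∑ (neg ∷ pos ∷ []) (G ∘ place j))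
    ∎
  where open ≡-Reasoning

∑-grid-double : ∀ k n (F : Vec (Fin (k + k)) n → ℕ) →
  ∑ (grid (k + k) n) F ≡ ∑ (grid k n) (λ z → ∑ (cube n) (F ∘ zipWith place z))
∑-grid-double k = ∑-allVecs-zipWith place (allFin k) (neg ∷ pos ∷ []) (allFin (k + k)) (∑-allFin-double k)

ind-neg : ∀ {m} (i : Fin m) → toℕ i < m ℕ./ 2 → ind i ≡ neg
ind-neg {m} i i<h with m ℕ./ 2 ℕ.<? suc (toℕ i)
... | yes h<1+i = contradiction i<h (ℕ.≤⇒≯ (ℕ.s≤s⁻¹ h<1+i))
... | no _      = refl

ind-pos : ∀ {m} (i : Fin m) → m ℕ./ 2 ≤ toℕ i → ind i ≡ pos
ind-pos {m} i h≤i with m ℕ./ 2 ℕ.<? suc (toℕ i)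
... | yes _     = refl
... | no h≮1+i = contradiction (s≤s h≤i) h≮1+i

ind-mono : ∀ {m} {i j : Fin m} → i ≤Fin j → ind i ≤± ind j
ind-mono {m} {i} {j} i≤j with m ℕ./ 2 ℕ.<? suc (toℕ i) | m ℕ./ 2 ℕ.<? suc (toℕ j)
... | yes _     | yes _     = pos≤pos
... | yes h<1+i | no h≮1+j = contradiction (ℕ.<-≤-trans h<1+i (s≤s i≤j)) h≮1+j
... | no _      | _         = neg≤

half-double : ∀ k → (k + k) ℕ./ 2 ≡ k
half-double k = trans (cong (ℕ._/ 2) (trans (cong (k +_) (sym (ℕ.+-identityʳ k))) (ℕ.*-comm 2 k))) (m*n/n≡m k 2)

ind-place : ∀ {k} (j : Fin k) a → ind (place j a) ≡ a
ind-place {k} j neg = ind-neg (place j neg) (subst (toℕ (place j neg) <_) (sym (half-double k)) (toℕ-place-neg<k j))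
ind-place {k} j pos = ind-pos (place j pos) (subst (_≤ toℕ (place j pos)) (sym (half-double k)) (k≤toℕ-place-pos j))

map-ind-zipWith-place : ∀ {k n} (z : Vec (Fin k) n) (b : Vec PM n) → Vec.map ind (zipWith place z b) ≡ b
map-ind-zipWith-place []      []      = refl
map-ind-zipWith-place (j ∷ z) (a ∷ b) = cong₂ _∷_ (ind-place j a) (map-ind-zipWith-place z b)

place-neg<place-pos : ∀ {k} (j : Fin k) → toℕ (place j neg) < toℕ (place j pos)
place-neg<place-pos j = ℕ.<-≤-trans (toℕ-place-neg<k j) (k≤toℕ-place-pos j)

place-mono : ∀ {k} (j : Fin k) {a a′} → a ≤± a′ → place j a ≤Fin place j a′
place-mono j {neg} {neg} neg≤ = ℕ.≤-refl
place-mono j {neg} {pos} neg≤ = ℕ.<⇒≤ (place-neg<place-pos j)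
place-mono j pos≤pos          = ℕ.≤-refl

place-injective : ∀ {k} (j : Fin k) {a a′} → place j a ≡ place j a′ → a ≡ a′
place-injective j {neg} {neg} _ = refl
place-injective j {neg} {pos} e = contradiction (cong toℕ e) (ℕ.<⇒≢ (place-neg<place-pos j))
place-injective j {pos} {neg} e = contradiction (cong toℕ (sym e)) (ℕ.<⇒≢ (place-neg<place-pos j))
place-injective j {pos} {pos} _ = refl

zipWith-place-injective : ∀ {k n} (z : Vec (Fin k) n) {b b′} → zipWith place z b ≡ zipWith place z b′ → b ≡ b′
zipWith-place-injective []      {[]}    {[]}      _ = refl
zipWith-place-injective (j ∷ z) {a ∷ b} {a′ ∷ b′} e =
  cong₂ _∷_ (place-injective j (Vec.∷-injectiveˡ e)) (zipWith-place-injective z (Vec.∷-injectiveʳ e))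

monotone-zipWith-place : ∀ {k n} {h : Vec (Fin (k + k)) n → PM} → Monotone _≤Fin_ h →
  (z : Vec (Fin k) n) → Monotone _≤±_ (h ∘ zipWith place z)
monotone-zipWith-place {h = h} mono z b b′ (b≤b′ , b≢b′) =
  mono (zipWith place z b) (zipWith place z b′) (placed-≤ , b≢b′ ∘ zipWith-place-injective z)
  where
  placed-≤ : ∀ i → lookup (zipWith place z b) i ≤Fin lookup (zipWith place z b′) i
  placed-≤ i = subst₂ _≤Fin_ (sym (Vec.lookup-zipWith place i z b)) (sym (Vec.lookup-zipWith place i z b′))
                 (place-mono (lookup z i) (b≤b′ i))

≤±-refl : ∀ a → a ≤± a
≤±-refl neg = neg≤
≤±-refl pos = pos≤pos

-- Monotone only speaks about x ≺ y, which excludes x ≡ y; decidable equality supplies that case.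
monotone-pointwise : ∀ {n} {_≤A_ : A → A → Set} → DecidableEquality A → (g : Vec A n → PM) →
  Monotone _≤A_ g → ∀ x y → (∀ i → lookup x i ≤A lookup y i) → g x ≤± g y
monotone-pointwise _≟_ g mono x y x≤y with Vec.≡-dec _≟_ x y
... | yes refl = ≤±-refl (g x)
... | no x≢y   = mono x y (x≤y , x≢y)

Φ-monotone : ∀ {m n} (f : Vec PM n → PM) → Monotone _≤±_ f → Monotone (_≤Fin_ {m}) (Φ {m} f)
Φ-monotone f mono x y (x≤y , _) = monotone-pointwise {_≤A_ = _≤±_} _≟±_ f mono (Vec.map ind x) (Vec.map ind y) ind-≤
  where
  ind-≤ : ∀ i → lookup (Vec.map ind x) i ≤± lookup (Vec.map ind y) i
  ind-≤ i = subst₂ _≤±_ (sym (Vec.lookup-map i ind x)) (sym (Vec.lookup-map i ind y)) (ind-mono (x≤y i))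

-- ℕtoℚ a is definitionally fromℚᵘ (ℕtoℚᵘ a).
ℕtoℚᵘ : ℕ → ℚᵘ
ℕtoℚᵘ a = mkℚᵘ (ℤ.+ a) 0

ℕtoℚᵘ-+ : ∀ a b → ℕtoℚᵘ (a + b) ℚᵘ.≃ ℕtoℚᵘ a ℚᵘ.+ ℕtoℚᵘ b
ℕtoℚᵘ-+ a b = *≡* (cong (ℤ._* ℤ.+ 1) (begin
  ℤ.+ (a + b)                        ≡⟨ ℤ.pos-+ a b ⟩
  ℤ.+ a ℤ.+ ℤ.+ b                    ≡⟨ cong₂ ℤ._+_ (ℤ.*-identityʳ (ℤ.+ a)) (ℤ.*-identityʳ (ℤ.+ b)) ⟨
  ℤ.+ a ℤ.* ℤ.+ 1 ℤ.+ ℤ.+ b ℤ.* ℤ.+ 1  ∎))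
  where open ≡-Reasoning

ℕtoℚ-+ : ∀ a b → ℕtoℚ (a + b) ≡ ℕtoℚ a ℚ.+ ℕtoℚ b
ℕtoℚ-+ a b = ℚ.toℚᵘ-injective (begin-equality
  toℚᵘ (ℕtoℚ (a + b))                ≃⟨ ℚ.toℚᵘ-fromℚᵘ (ℕtoℚᵘ (a + b)) ⟩
  ℕtoℚᵘ (a + b)                      ≃⟨ ℕtoℚᵘ-+ a b ⟩
  ℕtoℚᵘ a ℚᵘ.+ ℕtoℚᵘ b               ≃⟨ ℚᵘ.+-cong (ℚ.toℚᵘ-fromℚᵘ (ℕtoℚᵘ a)) (ℚ.toℚᵘ-fromℚᵘ (ℕtoℚᵘ b)) ⟨
  toℚᵘ (ℕtoℚ a) ℚᵘ.+ toℚᵘ (ℕtoℚ b)   ≃⟨ ℚ.toℚᵘ-homo-+ (ℕtoℚ a) (ℕtoℚ b) ⟨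
  toℚᵘ (ℕtoℚ a ℚ.+ ℕtoℚ b)           ∎)
  where open ℚᵘ.≤-Reasoning

*-∑-≤ : (ε : ℚ) (c : ℕ) (d : A → ℕ) (xs : List A) → (∀ x → ε ℚ.* ℕtoℚ c ℚ.< ℕtoℚ (d x)) →
  ε ℚ.* ℕtoℚ (∑ xs (λ _ → c)) ℚ.≤ ℕtoℚ (∑ xs d)
*-∑-≤ ε c d []       _ rewrite ℚ.*-zeroʳ ε = ℚ.≤-refl
*-∑-≤ ε c d (x ∷ xs) bound
  rewrite ℕtoℚ-+ c (∑ xs (λ _ → c)) | ℕtoℚ-+ (d x) (∑ xs d) | ℚ.*-distribˡ-+ ε (ℕtoℚ c) (ℕtoℚ (∑ xs (λ _ → c))) =
  ℚ.+-mono-≤ (ℚ.<⇒≤ (bound x)) (*-∑-≤ ε c d xs bound)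

*-∑-< : (ε : ℚ) (c : ℕ) (d : A → ℕ) (xs : List A) → 0 < length xs → (∀ x → ε ℚ.* ℕtoℚ c ℚ.< ℕtoℚ (d x)) →
  ε ℚ.* ℕtoℚ (∑ xs (λ _ → c)) ℚ.< ℕtoℚ (∑ xs d)
*-∑-< ε c d (x ∷ xs) _ bound
  rewrite ℕtoℚ-+ c (∑ xs (λ _ → c)) | ℕtoℚ-+ (d x) (∑ xs d) | ℚ.*-distribˡ-+ ε (ℕtoℚ c) (ℕtoℚ (∑ xs (λ _ → c))) =
  ℚ.+-mono-<-≤ (bound x) (*-∑-≤ ε c d xs bound)

Φ-farFromMonotone : ∀ k .{{_ : ℕ.NonZero k}} {n} (f : Vec PM n → PM) (ε : ℚ) →
  FarFromMonotone _≤±_ (cube n) ε f → FarFromMonotone (_≤Fin_ {k + k}) (grid (k + k) n) ε (Φ {k + k} f)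
Φ-farFromMonotone (suc k) {n} f ε far h mono =
  subst₂ (λ a b → ε ℚ.* ℕtoℚ a ℚ.< ℕtoℚ b) (sym length-grid) (sym disagree-grid)
    (*-∑-< ε (length (cube n)) (λ z → disagree (cube n) f (h ∘ zipWith place z)) (grid (suc k) n)
       (allVecs-nonempty n) (λ z → far (h ∘ zipWith place z) (monotone-zipWith-place mono z)))
  where
  open ≡-Reasoning
  length-grid : length (grid (suc k + suc k) n) ≡ ∑ (grid (suc k) n) (λ _ → length (cube n))
  length-grid = begin
    length (grid (suc k + suc k) n)                                  ≡⟨ length≡∑1 (grid (suc k + suc k) n) ⟩
    ∑ (grid (suc k + suc k) n) (λ _ → 1)                             ≡⟨ ∑-grid-double (suc k) n _ ⟩
    ∑ (grid (suc k) n) (λ _ → ∑ (cube n) (λ _ → 1))                  ≡⟨ ∑-cong (grid (suc k) n) (λ _ → length≡∑1 (cube n)) ⟨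
    ∑ (grid (suc k) n) (λ _ → length (cube n))                       ∎
  disagree-grid : disagree (grid (suc k + suc k) n) (Φ f) h ≡ ∑ (grid (suc k) n) (λ z → disagree (cube n) f (h ∘ zipWith place z))
  disagree-grid = begin
    disagree (grid (suc k + suc k) n) (Φ f) h
      ≡⟨ disagree≡∑mismatch (grid (suc k + suc k) n) (Φ f) h ⟩
    ∑ (grid (suc k + suc k) n) (λ x → mismatch (Φ f x) (h x))
      ≡⟨ ∑-grid-double (suc k) n _ ⟩
    ∑ (grid (suc k) n) (λ z → ∑ (cube n) (λ b → mismatch (f (Vec.map ind (zipWith place z b))) (h (zipWith place z b))))
      ≡⟨ ∑-cong (grid (suc k) n) (λ z → ∑-cong (cube n) (λ b →
           cong (λ b′ → mismatch (f b′) (h (zipWith place z b))) (map-ind-zipWith-place z b))) ⟩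
    ∑ (grid (suc k) n) (λ z → ∑ (cube n) (λ b → mismatch (f b) (h (zipWith place z b))))
      ≡⟨ ∑-cong (grid (suc k) n) (λ z → disagree≡∑mismatch (cube n) f (h ∘ zipWith place z)) ⟨
    ∑ (grid (suc k) n) (λ z → disagree (cube n) f (h ∘ zipWith place z))
      ∎

proposition4p1 : (m : ℕ) → Even m → 0 < m → (n : ℕ) → (f : Vec PM n → PM) →
    (Monotone _≤±_ f → Monotone (_≤Fin_ {m}) (Φ {m} f))
    × ((ε : ℚ) → FarFromMonotone _≤±_ (cube n) ε f → FarFromMonotone (_≤Fin_ {m}) (grid m n) ε (Φ {m} f))
proposition4p1 m (zero  , refl) ()
proposition4p1 m (suc k , refl) _ n f = Φ-monotone f , Φ-farFromMonotone (suc k) f
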